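{- Let $\mathcal{L}=(L_1,L_2,P,\&_1,\swarrow^1,\nwarrow_1,\dots,\&_n,\swarrow^n,\nwarrow_n)$ be a multi-adjoint property-oriented frame. Then the following data define a non-trivial quantaloid $\mathcal{Q}_P^{\mathcal{L}}$: (i) objects: $0,1,\dots,n,\infty$; (ii) hom-sets: $\mathcal{Q}_P^{\mathcal{L}}(0,i)=P$, $\mathcal{Q}_P^{\mathcal{L}}(i,\infty)=L_2$, $\mathcal{Q}_P^{\mathcal{L}}(0,\infty)=L_1$ for $i=1,\dots,n$; $\mathcal{Q}_P^{\mathcal{L}}(i,i)=\{\bot_{i,i}<\mathrm{id}_i\}$ for $i=0,1,\dots,n,\infty$; and $\mathcal{Q}_P^{\mathcal{L}}(i,j)=\{\bot_{i,j}\}$ (one element) whenever $0\le j<i\le\infty$ or $0<i<j<\infty$ (with the order $0<1<\dots<n<\infty$); (iii) composition: $v\circ u=u\,\&_i\,v$ for $u\in\mathcal{Q}_P^{\mathcal{L}}(0,i)=P$, $v\in\mathcal{Q}_P^{\mathcal{L}}(i,\infty)=L_2$ ($i=1,\dots,n$); composition with identities is given by the identity law, and all other composites are the bottom element of the relevant hom-set. Moreover, the left and right implications satisfy $w/u=w\nwarrow_i u$ and $v\backslash w=w\swarrow^i v$ for all $u\in P$, $v\in L_2$, $w\in\mathcal{Q}_P^{\mathcal{L}}(0,\infty)=L_1$ ($i=1,\dots,n$), all other implications being trivial.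
   Context: A multi-adjoint property-oriented frame $\mathcal{L}$ consists of complete lattices $L_1,L_2,P$ and, for $i=1,\dots,n$, maps $\&_i:P\times L_2\to L_1$, $\swarrow^i:L_1\times L_2\to P$, $\nwarrow_i:L_1\times P\to L_2$ such that $z\,\&_i\,y\le x\iff z\le x\swarrow^i y\iff y\le x\nwarrow_i z$ for all $z\in P$, $y\in L_2$, $x\in L_1$. A quantaloid is a category whose hom-sets are complete lattices and whose composition preserves arbitrary joins in each variable; for $u\in\mathcal{Q}(p,q)$, $v\in\mathcal{Q}(q,r)$, $w\in\mathcal{Q}(p,r)$ the left and right implications $w/u\in\mathcal{Q}(q,r)$, $v\backslash w\in\mathcal{Q}(p,q)$ are defined by $v\circ u\le w\iff v\le w/u\iff u\le v\backslash w$. It is non-trivial if $\bot_{q,q}<\mathrm{id}_q$ for every object $q$. -}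

module Defs where

open import Level using (Level; _⊔_) renaming (suc to lsuc)
open import Data.Nat using (ℕ)
open import Data.Fin using (Fin; zero; suc)
open import Data.Bool using (Bool; true; false; if_then_else_)
open import Data.Product using (Σ; _×_; _,_; proj₁)
open import Data.Unit.Polymorphic using (⊤; tt)
open import Data.Empty.Polymorphic using (⊥)
open import Relation.Nullary using (¬_)
open import Relation.Binary using (Rel; IsPartialOrder)
open import Function.Bundles using (_⇔_)

IsJoin : ∀ {c ℓ ι} {A : Set c} (_≤_ : Rel A ℓ) {I : Set ι} → (I → A) → A → Set (c ⊔ ℓ ⊔ ι)
IsJoin {A = A} _≤_ {I} f j = (∀ i → f i ≤ j) × (∀ (u : A) → (∀ i → f i ≤ u) → j ≤ u)

record CompleteLattice (c ℓ₁ ℓ₂ ι : Level) : Set (lsuc (c ⊔ ℓ₁ ⊔ ℓ₂ ⊔ ι)) where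
  field
    Carrier        : Set c
    _≈_            : Rel Carrier ℓ₁
    _≤_            : Rel Carrier ℓ₂
    isPartialOrder : IsPartialOrder _≈_ _≤_
    joins          : ∀ {I : Set ι} (f : I → Carrier) → Σ Carrier (IsJoin _≤_ f)

  bot : Carrier
  bot = proj₁ (joins {I = ⊥} (λ ()))

open CompleteLattice using (Carrier)

record MultiAdjointPropertyOrientedFrame (n : ℕ) (c ℓ₁ ℓ₂ ι : Level) : Set (lsuc (c ⊔ ℓ₁ ⊔ ℓ₂ ⊔ ι)) where
  field
    L₁ L₂ P : CompleteLattice c ℓ₁ ℓ₂ ι
    conj : Fin n → Carrier P → Carrier L₂ → Carrier L₁
    -- x ↙ⁱ y
    impL : Fin n → Carrier L₁ → Carrier L₂ → Carrier P
    -- x ↖ᵢ z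
    impR : Fin n → Carrier L₁ → Carrier P → Carrier L₂
    adjoint₁ : ∀ i (z : Carrier P) (y : Carrier L₂) (x : Carrier L₁) →
               CompleteLattice._≤_ L₁ (conj i z y) x ⇔ CompleteLattice._≤_ P z (impL i x y)
    adjoint₂ : ∀ i (z : Carrier P) (y : Carrier L₂) (x : Carrier L₁) →
               CompleteLattice._≤_ P z (impL i x y) ⇔ CompleteLattice._≤_ L₂ y (impR i x z)

record CatData (o c ℓ₁ ℓ₂ : Level) : Set (lsuc (o ⊔ c ⊔ ℓ₁ ⊔ ℓ₂)) where
  field
    Obj  : Set o
    Hom  : Obj → Obj → Set c
    Eq   : ∀ a b → Rel (Hom a b) ℓ₁
    Leq  : ∀ a b → Rel (Hom a b) ℓ₂
    comp : ∀ a b c → Hom b c → Hom a b → Hom a c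
    idm  : ∀ a → Hom a a

record IsQuantaloid {o c ℓ₁ ℓ₂} (ι : Level) (Q : CatData o c ℓ₁ ℓ₂) : Set (o ⊔ c ⊔ ℓ₁ ⊔ ℓ₂ ⊔ lsuc ι) where
  open CatData Q
  field
    isPartialOrder : ∀ a b → IsPartialOrder (Eq a b) (Leq a b)
    joins          : ∀ a b {I : Set ι} (f : I → Hom a b) → Σ (Hom a b) (IsJoin (Leq a b) f)
    comp-cong  : ∀ a b c {v v′ : Hom b c} {u u′ : Hom a b} →
                 Eq b c v v′ → Eq a b u u′ → Eq a c (comp a b c v u) (comp a b c v′ u′)
    assoc      : ∀ a b c d (w : Hom c d) (v : Hom b c) (u : Hom a b) →
                 Eq a d (comp a c d w (comp a b c v u)) (comp a b d (comp b c d w v) u)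
    identityˡ  : ∀ a b (u : Hom a b) → Eq a b (comp a b b (idm b) u) u
    identityʳ  : ∀ a b (u : Hom a b) → Eq a b (comp a a b u (idm a)) u
    comp-joinˡ : ∀ a b c (v : Hom b c) {I : Set ι} (f : I → Hom a b) (j : Hom a b) →
                 IsJoin (Leq a b) f j → IsJoin (Leq a c) (λ k → comp a b c v (f k)) (comp a b c v j)
    comp-joinʳ : ∀ a b c (u : Hom a b) {I : Set ι} (f : I → Hom b c) (j : Hom b c) →
                 IsJoin (Leq b c) f j → IsJoin (Leq a c) (λ k → comp a b c (f k) u) (comp a b c j u)

NonTrivial : ∀ {o c ℓ₁ ℓ₂} (Q : CatData o c ℓ₁ ℓ₂) → Set (o ⊔ c ⊔ ℓ₁ ⊔ ℓ₂)
NonTrivial Q = ∀ q (b : Hom q q) → (∀ x → Leq q q b x) → Leq q q b (idm q) × ¬ Eq q q b (idm q)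
  where open CatData Q

IsLeftImplication : ∀ {o c ℓ₁ ℓ₂} (Q : CatData o c ℓ₁ ℓ₂) {p q r} →
                    CatData.Hom Q p q → CatData.Hom Q p r → CatData.Hom Q q r → Set (c ⊔ ℓ₂)
IsLeftImplication Q {p} {q} {r} u w res = ∀ v → (Leq p r (comp p q r v u) w ⇔ Leq q r v res)
  where open CatData Q

IsRightImplication : ∀ {o c ℓ₁ ℓ₂} (Q : CatData o c ℓ₁ ℓ₂) {p q r} →
                     CatData.Hom Q q r → CatData.Hom Q p r → CatData.Hom Q p q → Set (c ⊔ ℓ₂)
IsRightImplication Q {p} {q} {r} v w res = ∀ u → (Leq p r (comp p q r v u) w ⇔ Leq p q u res)
  where open CatData Q

data Two {c} : Set c where
  bot₂ id₂ : Two

_≈₂_ : ∀ {c ℓ} → Two {c} → Two {c} → Set ℓ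
bot₂ ≈₂ bot₂ = ⊤
bot₂ ≈₂ id₂  = ⊥
id₂  ≈₂ bot₂ = ⊥
id₂  ≈₂ id₂  = ⊤

_≤₂_ : ∀ {c ℓ} → Two {c} → Two {c} → Set ℓ
bot₂ ≤₂ _    = ⊤
id₂  ≤₂ bot₂ = ⊥
id₂  ≤₂ id₂  = ⊤

_∧₂_ : ∀ {c} → Two {c} → Two {c} → Two {c}
id₂  ∧₂ u = u
bot₂ ∧₂ u = bot₂

isId₂ : ∀ {c} → Two {c} → Bool
isId₂ id₂  = true
isId₂ bot₂ = false

One : ∀ {c} → Set c
One = ⊤

data Obj (n : ℕ) : Set where
  𝟎   : Obj n
  mid : Fin n → Obj n
  ∞   : Obj n

module Construction {n c ℓ₁ ℓ₂ ι} (𝓛 : MultiAdjointPropertyOrientedFrame n c ℓ₁ ℓ₂ ι) where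
  open MultiAdjointPropertyOrientedFrame 𝓛
  module L₁ = CompleteLattice L₁
  module L₂ = CompleteLattice L₂
  module P  = CompleteLattice P

  midGo : ∀ {m} → Fin m → Fin m → Set c
  midGo zero    zero    = Two
  midGo zero    (suc j) = One
  midGo (suc i) zero    = One
  midGo (suc i) (suc j) = midGo i j

  midEq : ∀ {m} (i j : Fin m) → Rel (midGo i j) ℓ₁
  midEq zero    zero    = _≈₂_
  midEq zero    (suc j) = λ _ _ → ⊤
  midEq (suc i) zero    = λ _ _ → ⊤
  midEq (suc i) (suc j) = midEq i j

  midLeq : ∀ {m} (i j : Fin m) → Rel (midGo i j) ℓ₂
  midLeq zero    zero    = _≤₂_
  midLeq zero    (suc j) = λ _ _ → ⊤
  midLeq (suc i) zero    = λ _ _ → ⊤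
  midLeq (suc i) (suc j) = midLeq i j

  midBot : ∀ {m} (i j : Fin m) → midGo i j
  midBot zero    zero    = bot₂
  midBot zero    (suc j) = tt
  midBot (suc i) zero    = tt
  midBot (suc i) (suc j) = midBot i j

  midId : ∀ {m} (i : Fin m) → midGo i i
  midId zero    = id₂
  midId (suc i) = midId i

  midIsId : ∀ {m} (i j : Fin m) → midGo i j → Bool
  midIsId zero    zero    t = isId₂ t
  midIsId zero    (suc j) _ = false
  midIsId (suc i) zero    _ = false
  midIsId (suc i) (suc j) t = midIsId i j t

  midComp : ∀ {m} (i j k : Fin m) → midGo j k → midGo i j → midGo i k
  midComp zero    zero    zero    v u = v ∧₂ u
  midComp zero    zero    (suc k) v u = tt
  midComp zero    (suc j) zero    v u = bot₂
  midComp zero    (suc j) (suc k) v u = tt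
  midComp (suc i) j       zero    v u = tt
  midComp (suc i) zero    (suc k) v u = midBot i k
  midComp (suc i) (suc j) (suc k) v u = midComp i j k v u

  Hom : Obj n → Obj n → Set c
  Hom 𝟎       𝟎       = Two
  Hom 𝟎       (mid i) = Carrier P
  Hom 𝟎       ∞       = Carrier L₁
  Hom (mid i) 𝟎       = One
  Hom (mid i) (mid j) = midGo i j
  Hom (mid i) ∞       = Carrier L₂
  Hom ∞       𝟎       = One
  Hom ∞       (mid j) = One
  Hom ∞       ∞       = Two

  Eq : ∀ a b → Rel (Hom a b) ℓ₁
  Eq 𝟎       𝟎       = _≈₂_
  Eq 𝟎       (mid i) = P._≈_
  Eq 𝟎       ∞       = L₁._≈_
  Eq (mid i) 𝟎       = λ _ _ → ⊤
  Eq (mid i) (mid j) = midEq i j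
  Eq (mid i) ∞       = L₂._≈_
  Eq ∞       𝟎       = λ _ _ → ⊤
  Eq ∞       (mid j) = λ _ _ → ⊤
  Eq ∞       ∞       = _≈₂_

  Leq : ∀ a b → Rel (Hom a b) ℓ₂
  Leq 𝟎       𝟎       = _≤₂_
  Leq 𝟎       (mid i) = P._≤_
  Leq 𝟎       ∞       = L₁._≤_
  Leq (mid i) 𝟎       = λ _ _ → ⊤
  Leq (mid i) (mid j) = midLeq i j
  Leq (mid i) ∞       = L₂._≤_
  Leq ∞       𝟎       = λ _ _ → ⊤
  Leq ∞       (mid j) = λ _ _ → ⊤
  Leq ∞       ∞       = _≤₂_

  idm : ∀ a → Hom a a
  idm 𝟎       = id₂
  idm (mid i) = midId i
  idm ∞       = id₂

  scale : ∀ {X : Set c} → X → Two {c} → X → X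
  scale ⊥X t x = if isId₂ t then x else ⊥X

  comp : ∀ a b c → Hom b c → Hom a b → Hom a c
  comp 𝟎       𝟎       𝟎       v u = v ∧₂ u
  comp 𝟎       𝟎       (mid k) v u = scale P.bot u v
  comp 𝟎       𝟎       ∞       v u = scale L₁.bot u v
  comp 𝟎       (mid j) 𝟎       v u = bot₂
  comp 𝟎       (mid j) (mid k) v u = if midIsId j k v then u else P.bot
  comp 𝟎       (mid j) ∞       v u = conj j u v
  comp 𝟎       ∞       𝟎       v u = bot₂
  comp 𝟎       ∞       (mid k) v u = P.bot
  comp 𝟎       ∞       ∞       v u = scale L₁.bot v u
  comp (mid i) 𝟎       𝟎       v u = tt
  comp (mid i) 𝟎       (mid k) v u = midBot i k
  comp (mid i) 𝟎       ∞       v u = L₂.bot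
  comp (mid i) (mid j) 𝟎       v u = tt
  comp (mid i) (mid j) (mid k) v u = midComp i j k v u
  comp (mid i) (mid j) ∞       v u = if midIsId i j u then v else L₂.bot
  comp (mid i) ∞       𝟎       v u = tt
  comp (mid i) ∞       (mid k) v u = midBot i k
  comp (mid i) ∞       ∞       v u = scale L₂.bot v u
  comp ∞       𝟎       𝟎       v u = tt
  comp ∞       𝟎       (mid k) v u = tt
  comp ∞       𝟎       ∞       v u = bot₂
  comp ∞       (mid j) 𝟎       v u = tt
  comp ∞       (mid j) (mid k) v u = tt
  comp ∞       (mid j) ∞       v u = bot₂
  comp ∞       ∞       𝟎       v u = tt
  comp ∞       ∞       (mid k) v u = tt
  comp ∞       ∞       ∞       v u = v ∧₂ u

  Q : CatData _ c ℓ₁ ℓ₂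
  Q = record { Obj = Obj n ; Hom = Hom ; Eq = Eq ; Leq = Leq ; comp = comp ; idm = idm }

Q-P : ∀ {n c ℓ₁ ℓ₂ ι} → MultiAdjointPropertyOrientedFrame n c ℓ₁ ℓ₂ ι → CatData _ c ℓ₁ ℓ₂
Q-P 𝓛 = Construction.Q 𝓛

module Submission where

-- Except for Q(0,i) = P, Q(i,∞) = L₂ and Q(0,∞) = L₁, every hom-set is {⊥ < id} or a
-- singleton, and every composite is u &ᵢ v, a composite with an identity, or ⊥. So the
-- quantaloid laws come down to a finite case analysis whose only real inputs are that
-- &ᵢ is a left adjoint in each variable (to ↙ⁱ and, composing the adjoint triple, to ↖ᵢ):
-- hence it is monotone, strict in both arguments and preserves all joins in each of
-- them. The same adjunctions are exactly the claimed formulas for w / u and v \ w.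

open import Defs
open import Level using (Level)
open import Data.Nat using (ℕ)
open import Data.Fin using (Fin; zero; suc)
open import Data.Bool using (true; false; _∧_; if_then_else_)
open import Data.Bool.Properties using (∧-zeroʳ; ∧-comm)
open import Data.Product using (Σ; ∃; _×_; _,_; proj₂)
open import Data.Unit.Polymorphic using (⊤; tt)
open import Data.Empty using (⊥-elim)
open import Axiom.ExcludedMiddle using (ExcludedMiddle)
open import Relation.Nullary using (¬_; yes; no)
open import Relation.Binary using (Rel; IsPartialOrder; Reflexive; Transitive)
open import Relation.Binary.PropositionalEquality as ≡ using (_≡_; refl; cong; subst)
open import Function.Bundles using (_⇔_; Equivalence)
open import Function.Construct.Composition using (_⇔-∘_)

open Equivalence using (to; from)

bot-minimum : ∀ {c ℓ₁ ℓ₂ ι} (L : CompleteLattice c ℓ₁ ℓ₂ ι) →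
              ∀ x → CompleteLattice._≤_ L (CompleteLattice.bot L) x
bot-minimum L x = proj₂ (proj₂ (CompleteLattice.joins L _)) x (λ ())

module LeftAdjoint {a b ℓa ℓb} {A : Set a} {B : Set b} {_≤A_ : Rel A ℓa} {_≤B_ : Rel B ℓb}
                   (≤A-trans : Transitive _≤A_) (≤B-refl : Reflexive _≤B_)
                   (h : A → B) (r : B → A) (h⊣r : ∀ x y → h x ≤B y ⇔ x ≤A r y) where

  mono : ∀ {x y} → x ≤A y → h x ≤B h y
  mono {x} {y} x≤y = from (h⊣r x (h y)) (≤A-trans x≤y (to (h⊣r y (h y)) ≤B-refl))

  preserves-minimum : ∀ {⊥A} → (∀ x → ⊥A ≤A x) → ∀ y → h ⊥A ≤B y
  preserves-minimum {⊥A} ⊥A-minimum y = from (h⊣r ⊥A y) (⊥A-minimum (r y))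

  preserves-joins : ∀ {ι} {I : Set ι} (f : I → A) j → IsJoin _≤A_ f j → IsJoin _≤B_ (λ k → h (f k)) (h j)
  preserves-joins f j (ub , lub) =
    (λ k → mono (ub k)) ,
    (λ u hu → from (h⊣r j u) (lub (r u) (λ k → to (h⊣r (f k) u) (hu k))))

IsJoin-resp : ∀ {a ℓ₁ ℓ₂ ι} {A : Set a} {_≈_ : Rel A ℓ₁} {_≤_ : Rel A ℓ₂} →
              IsPartialOrder _≈_ _≤_ → ∀ {I : Set ι} {f g : I → A} {j j′} →
              (∀ k → g k ≈ f k) → j′ ≈ j → IsJoin _≤_ f j → IsJoin _≤_ g j′
IsJoin-resp po g≈f j′≈j (ub , lub) =
  (λ k → trans (reflexive (g≈f k)) (trans (ub k) (reflexive (Eq.sym j′≈j)))) ,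
  (λ u hu → trans (reflexive j′≈j) (lub u (λ k → trans (reflexive (Eq.sym (g≈f k))) (hu k))))
  where open IsPartialOrder po

module TwoProperties {c : Level} where

  ≈₂⇒≡ : ∀ {ℓ} {t u : Two {c}} → _≈₂_ {ℓ = ℓ} t u → t ≡ u
  ≈₂⇒≡ {t = bot₂} {bot₂} _ = refl
  ≈₂⇒≡ {t = id₂}  {id₂}  _ = refl

  ≡⇒≈₂ : ∀ {ℓ} {t u : Two {c}} → t ≡ u → _≈₂_ {ℓ = ℓ} t u
  ≡⇒≈₂ {t = bot₂} refl = tt
  ≡⇒≈₂ {t = id₂}  refl = tt

  ≈₂-refl : ∀ {ℓ} (t : Two {c}) → _≈₂_ {ℓ = ℓ} t t
  ≈₂-refl t = ≡⇒≈₂ refl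

  ≤₂-refl : ∀ {ℓ} {t : Two {c}} → _≤₂_ {ℓ = ℓ} t t
  ≤₂-refl {t = bot₂} = tt
  ≤₂-refl {t = id₂}  = tt

  isId₂⇒≡id₂ : ∀ {t : Two {c}} → isId₂ t ≡ true → t ≡ id₂
  isId₂⇒≡id₂ {id₂} _ = refl

  ≤₂-top : ∀ {ℓ} (t : Two {c}) → _≤₂_ {ℓ = ℓ} t id₂
  ≤₂-top bot₂ = tt
  ≤₂-top id₂  = tt

  ≤₂-isPartialOrder : ∀ {ℓ ℓ′} → IsPartialOrder (_≈₂_ {c} {ℓ}) (_≤₂_ {c} {ℓ′})
  ≤₂-isPartialOrder {ℓ} {ℓ′} = record
    { isPreorder = record
      { isEquivalence = record
        { refl  = ≈₂-refl _
        ; sym   = λ t≈u → ≡⇒≈₂ (≡.sym (≈₂⇒≡ t≈u))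
        ; trans = λ t≈u u≈v → ≡⇒≈₂ (≡.trans (≈₂⇒≡ t≈u) (≈₂⇒≡ u≈v))
        }
      ; reflexive = λ t≈u → subst (_≤₂_ _) (≈₂⇒≡ t≈u) ≤₂-refl
      ; trans     = ≤₂-trans
      }
    ; antisym = ≤₂-antisym
    }
    where
    ≤₂-trans : ∀ {t u v : Two {c}} → _≤₂_ {ℓ = ℓ′} t u → _≤₂_ {ℓ = ℓ′} u v → _≤₂_ {ℓ = ℓ′} t v
    ≤₂-trans {bot₂}             _ _ = tt
    ≤₂-trans {id₂} {id₂} {id₂}  _ _ = tt

    ≤₂-antisym : ∀ {t u : Two {c}} → _≤₂_ {ℓ = ℓ′} t u → _≤₂_ {ℓ = ℓ′} u t → _≈₂_ {ℓ = ℓ} t u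
    ≤₂-antisym {bot₂} {bot₂} _ _ = tt
    ≤₂-antisym {id₂}  {id₂}  _ _ = tt

  Two-nonTrivial : ∀ {ℓ ℓ′} (b : Two {c}) → (∀ t → _≤₂_ {ℓ = ℓ′} b t) →
                   _≤₂_ {ℓ = ℓ′} b id₂ × ¬ _≈₂_ {ℓ = ℓ} b id₂
  Two-nonTrivial bot₂ _ = tt , λ ()
  Two-nonTrivial id₂ b-min with b-min bot₂
  ... | ()

  ∧₂-identityʳ : ∀ (t : Two {c}) → t ∧₂ id₂ ≡ t
  ∧₂-identityʳ id₂  = refl
  ∧₂-identityʳ bot₂ = refl

  ∧₂-zeroʳ : ∀ (t : Two {c}) → t ∧₂ bot₂ ≡ bot₂
  ∧₂-zeroʳ id₂  = refl
  ∧₂-zeroʳ bot₂ = refl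

  ∧₂-assoc : ∀ (t u v : Two {c}) → t ∧₂ (u ∧₂ v) ≡ (t ∧₂ u) ∧₂ v
  ∧₂-assoc id₂  u v = refl
  ∧₂-assoc bot₂ u v = refl

  ∧₂-cong : ∀ {ℓ} {t t′ u u′ : Two {c}} → _≈₂_ {ℓ = ℓ} t t′ → _≈₂_ {ℓ = ℓ} u u′ →
            _≈₂_ {ℓ = ℓ} (t ∧₂ u) (t′ ∧₂ u′)
  ∧₂-cong t≈t′ u≈u′ = ≡⇒≈₂ (≡.cong₂ _∧₂_ (≈₂⇒≡ t≈t′) (≈₂⇒≡ u≈u′))

⊤-isPartialOrder : ∀ {c ℓ ℓ′} → IsPartialOrder {A = One {c}} (λ _ _ → ⊤ {ℓ}) (λ _ _ → ⊤ {ℓ′})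
⊤-isPartialOrder = record
  { isPreorder = record
    { isEquivalence = record { refl = tt ; sym = λ _ → tt ; trans = λ _ _ → tt }
    ; reflexive = λ _ → tt
    ; trans = λ _ _ → tt
    }
  ; antisym = λ _ _ → tt
  }

One-joins : ∀ {c ℓ ι} {I : Set ι} (f : I → One {c}) → Σ One (IsJoin (λ _ _ → ⊤ {ℓ}) f)
One-joins f = tt , (λ _ → tt) , (λ _ _ → tt)

-- Joins in {⊥ < id} need excluded middle: the join is id exactly when some member is id.
-- That is asked through [isId₂], since excluded middle only decides propositions in [Set ι].
module TwoJoins {c ι : Level} (em : ExcludedMiddle ι) where
  open TwoProperties {c}

  ≤₂-bot-unless-id : ∀ {ℓ} {I : Set ι} (f : I → Two {c}) →
                     ¬ (∃ λ k → isId₂ (f k) ≡ true) → ∀ k → _≤₂_ {ℓ = ℓ} (f k) bot₂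
  ≤₂-bot-unless-id f no-id k with f k in fk≡
  ... | bot₂ = tt
  ... | id₂  = ⊥-elim (no-id (k , cong isId₂ fk≡))

  Two-joins : ∀ {ℓ} {I : Set ι} (f : I → Two {c}) → Σ Two (IsJoin (_≤₂_ {ℓ = ℓ}) f)
  Two-joins f with em {∃ λ k → isId₂ (f k) ≡ true}
  ... | yes (k , fk-id) =
    id₂ , (λ k → ≤₂-top (f k)) , (λ u ub → subst (λ t → _≤₂_ t u) (isId₂⇒≡id₂ fk-id) (ub k))
  ... | no no-id        = bot₂ , ≤₂-bot-unless-id f no-id , (λ _ _ → tt)

  isJoin-id₂⇒∃ : ∀ {ℓ} {I : Set ι} {f : I → Two {c}} → IsJoin (_≤₂_ {ℓ = ℓ}) f id₂ → ∃ λ k → f k ≡ id₂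
  isJoin-id₂⇒∃ {f = f} (_ , lub) with em {∃ λ k → isId₂ (f k) ≡ true}
  ... | yes (k , fk-id) = k , isId₂⇒≡id₂ fk-id
  ... | no no-id with lub bot₂ (≤₂-bot-unless-id f no-id)
  ... | ()

-- [if β then x else ⊥A] is how the construction composes x with id (β true) or with ⊥ (β false).
module Bottomed {a ℓ₁ ℓ₂} {A : Set a} {_≈_ : Rel A ℓ₁} {_≤_ : Rel A ℓ₂}
                (isPartialOrder : IsPartialOrder _≈_ _≤_) (⊥A : A) (⊥A-minimum : ∀ x → ⊥A ≤ x) where
  open IsPartialOrder isPartialOrder renaming (refl to ≤-refl)
  open TwoProperties

  const-⊥-isJoin : ∀ {ι} {I : Set ι} → IsJoin _≤_ {I} (λ _ → ⊥A) ⊥A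
  const-⊥-isJoin = (λ _ → ≤-refl) , (λ u _ → ⊥A-minimum u)

  if-isJoin : ∀ β {ι} {I : Set ι} (f : I → A) j → IsJoin _≤_ f j →
              IsJoin _≤_ (λ k → if β then f k else ⊥A) (if β then j else ⊥A)
  if-isJoin true  f j f∨ = f∨
  if-isJoin false f j f∨ = const-⊥-isJoin

  scale-isJoin : ∀ {c ι ℓ} → ExcludedMiddle ι → ∀ x {I : Set ι} (f : I → Two {c}) j →
                 IsJoin (_≤₂_ {ℓ = ℓ}) f j →
                 IsJoin _≤_ (λ k → if isId₂ (f k) then x else ⊥A) (if isId₂ j then x else ⊥A)
  scale-isJoin {ℓ = ℓ} em x f bot₂ (ub , _) = (λ k → ≤⊥ (f k) (ub k)) , (λ u _ → ⊥A-minimum u)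
    where
    ≤⊥ : ∀ t → _≤₂_ {ℓ = ℓ} t bot₂ → (if isId₂ t then x else ⊥A) ≤ ⊥A
    ≤⊥ bot₂ _ = ≤-refl
  scale-isJoin em x f id₂ f∨ = (λ k → ≤x (f k)) , lub
    where
    ≤x : ∀ t → (if isId₂ t then x else ⊥A) ≤ x
    ≤x bot₂ = ⊥A-minimum x
    ≤x id₂  = ≤-refl

    lub : ∀ u → (∀ k → (if isId₂ (f k) then x else ⊥A) ≤ u) → x ≤ u
    lub u hu with TwoJoins.isJoin-id₂⇒∃ em f∨
    ... | k , fk≡id = subst (λ t → (if isId₂ t then x else ⊥A) ≤ u) fk≡id (hu k)

  if-cong : ∀ {β β′ x x′} → β ≡ β′ → x ≈ x′ → (if β then x else ⊥A) ≈ (if β′ then x′ else ⊥A)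
  if-cong {true}  refl x≈x′ = x≈x′
  if-cong {false} refl _    = Eq.refl

  scale-cong : ∀ {c ℓ} {t t′ : Two {c}} {x x′} → _≈₂_ {ℓ = ℓ} t t′ → x ≈ x′ →
               (if isId₂ t then x else ⊥A) ≈ (if isId₂ t′ then x′ else ⊥A)
  scale-cong t≈t′ = if-cong (cong isId₂ (≈₂⇒≡ t≈t′))

  if-∧ : ∀ β γ x → (if β then (if γ then x else ⊥A) else ⊥A) ≈ (if β ∧ γ then x else ⊥A)
  if-∧ true  γ x = Eq.refl
  if-∧ false γ x = Eq.refl

  if-comm : ∀ β γ x → (if β then (if γ then x else ⊥A) else ⊥A) ≈ (if γ then (if β then x else ⊥A) else ⊥A)
  if-comm β γ x = Eq.trans (if-∧ β γ x) (Eq.trans (if-cong (∧-comm β γ) Eq.refl) (Eq.sym (if-∧ γ β x)))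

  if-⊥ : ∀ β → (if β then ⊥A else ⊥A) ≈ ⊥A
  if-⊥ true  = Eq.refl
  if-⊥ false = Eq.refl

module FrameProperties {n c ℓ₁ ℓ₂ ι} (𝓛 : MultiAdjointPropertyOrientedFrame n c ℓ₁ ℓ₂ ι) where
  open MultiAdjointPropertyOrientedFrame 𝓛
  private
    module L₁ = CompleteLattice L₁
    module L₂ = CompleteLattice L₂
    module P  = CompleteLattice P
    module O₁ = IsPartialOrder L₁.isPartialOrder
    module O₂ = IsPartialOrder L₂.isPartialOrder
    module OP = IsPartialOrder P.isPartialOrder

  conj-adjointʳ : ∀ i z y x → L₁._≤_ (conj i z y) x ⇔ L₂._≤_ y (impR i x z)
  conj-adjointʳ i z y x = adjoint₂ i z y x ⇔-∘ adjoint₁ i z y x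

  module Conjˡ (i : Fin n) (y : L₂.Carrier) =
    LeftAdjoint {_≤A_ = P._≤_} {_≤B_ = L₁._≤_} OP.trans O₁.refl
                (λ z → conj i z y) (λ x → impL i x y) (λ z x → adjoint₁ i z y x)
  module Conjʳ (i : Fin n) (z : P.Carrier) =
    LeftAdjoint {_≤A_ = L₂._≤_} {_≤B_ = L₁._≤_} O₂.trans O₁.refl
                (conj i z) (λ x → impR i x z) (conj-adjointʳ i z)

  conj-cong : ∀ i {z z′ y y′} → P._≈_ z z′ → L₂._≈_ y y′ → L₁._≈_ (conj i z y) (conj i z′ y′)
  conj-cong i z≈z′ y≈y′ = O₁.antisym
    (O₁.trans (Conjˡ.mono i _ (OP.reflexive z≈z′)) (Conjʳ.mono i _ (O₂.reflexive y≈y′)))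
    (O₁.trans (Conjˡ.mono i _ (OP.reflexive (OP.Eq.sym z≈z′))) (Conjʳ.mono i _ (O₂.reflexive (O₂.Eq.sym y≈y′))))

  conj-zeroˡ : ∀ i y → L₁._≈_ (conj i P.bot y) L₁.bot
  conj-zeroˡ i y = O₁.antisym (Conjˡ.preserves-minimum i y (bot-minimum P) _) (bot-minimum L₁ _)

  conj-zeroʳ : ∀ i z → L₁._≈_ (conj i z L₂.bot) L₁.bot
  conj-zeroʳ i z = O₁.antisym (Conjʳ.preserves-minimum i z (bot-minimum L₂) _) (bot-minimum L₁ _)

module QuantaloidQP {n c ℓ₁ ℓ₂ ι} (em : ExcludedMiddle ι) (𝓛 : MultiAdjointPropertyOrientedFrame n c ℓ₁ ℓ₂ ι) where
  open MultiAdjointPropertyOrientedFrame 𝓛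
  open Construction 𝓛
  open FrameProperties 𝓛
  open TwoProperties {c}
  open TwoJoins {c} em

  mid-isPartialOrder : ∀ {m} (i j : Fin m) → IsPartialOrder (midEq i j) (midLeq i j)
  mid-isPartialOrder zero    zero    = ≤₂-isPartialOrder
  mid-isPartialOrder zero    (suc j) = ⊤-isPartialOrder
  mid-isPartialOrder (suc i) zero    = ⊤-isPartialOrder
  mid-isPartialOrder (suc i) (suc j) = mid-isPartialOrder i j

  midBot-minimum : ∀ {m} (i j : Fin m) x → midLeq i j (midBot i j) x
  midBot-minimum zero    zero    x = tt
  midBot-minimum zero    (suc j) x = tt
  midBot-minimum (suc i) zero    x = tt
  midBot-minimum (suc i) (suc j) x = midBot-minimum i j x

  module MidOrder {m} (i j : Fin m) = IsPartialOrder (mid-isPartialOrder i j)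
  module Mid⊥ {m} (i j : Fin m) = Bottomed (mid-isPartialOrder i j) (midBot i j) (midBot-minimum i j)

  mid-joins : ∀ {m} (i j : Fin m) {I : Set ι} (f : I → midGo i j) → Σ (midGo i j) (IsJoin (midLeq i j) f)
  mid-joins zero    zero    f = Two-joins f
  mid-joins zero    (suc j) f = One-joins f
  mid-joins (suc i) zero    f = One-joins f
  mid-joins (suc i) (suc j) f = mid-joins i j f

  midIsId-midId : ∀ {m} (i : Fin m) → midIsId i i (midId i) ≡ true
  midIsId-midId zero    = refl
  midIsId-midId (suc i) = midIsId-midId i

  midIsId-midBot : ∀ {m} (i j : Fin m) → midIsId i j (midBot i j) ≡ false
  midIsId-midBot zero    zero    = refl
  midIsId-midBot zero    (suc j) = refl
  midIsId-midBot (suc i) zero    = refl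
  midIsId-midBot (suc i) (suc j) = midIsId-midBot i j

  midIsId⇒≡ : ∀ {m} (i j : Fin m) v → midIsId i j v ≡ true → i ≡ j
  midIsId⇒≡ zero    zero    v _ = refl
  midIsId⇒≡ (suc i) (suc j) v e = cong suc (midIsId⇒≡ i j v e)

  midIsId-cong : ∀ {m} (i j : Fin m) {v v′} → midEq i j v v′ → midIsId i j v ≡ midIsId i j v′
  midIsId-cong zero    zero    v≈v′ = cong isId₂ (≈₂⇒≡ v≈v′)
  midIsId-cong zero    (suc j) _    = refl
  midIsId-cong (suc i) zero    _    = refl
  midIsId-cong (suc i) (suc j) v≈v′ = midIsId-cong i j v≈v′

  midIsId-midComp : ∀ {m} (i j k : Fin m) v u → midIsId i k (midComp i j k v u) ≡ (midIsId j k v ∧ midIsId i j u)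
  midIsId-midComp zero    zero    zero    id₂  u = refl
  midIsId-midComp zero    zero    zero    bot₂ u = refl
  midIsId-midComp zero    zero    (suc k) v    u = refl
  midIsId-midComp zero    (suc j) zero    v    u = refl
  midIsId-midComp zero    (suc j) (suc k) v    u = ≡.sym (∧-zeroʳ _)
  midIsId-midComp (suc i) zero    zero    v    u = ≡.sym (∧-zeroʳ _)
  midIsId-midComp (suc i) (suc j) zero    v    u = refl
  midIsId-midComp (suc i) zero    (suc k) v    u = midIsId-midBot i k
  midIsId-midComp (suc i) (suc j) (suc k) v    u = midIsId-midComp i j k v u

  midComp-identityˡ : ∀ {m} (i k : Fin m) u → midEq i k (midComp i k k (midId k) u) u
  midComp-identityˡ zero    zero    u = ≈₂-refl u
  midComp-identityˡ zero    (suc k) u = tt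
  midComp-identityˡ (suc i) zero    u = tt
  midComp-identityˡ (suc i) (suc k) u = midComp-identityˡ i k u

  midComp-identityʳ : ∀ {m} (i k : Fin m) v → midEq i k (midComp i i k v (midId i)) v
  midComp-identityʳ zero    zero    v = ≡⇒≈₂ (∧₂-identityʳ v)
  midComp-identityʳ zero    (suc k) v = tt
  midComp-identityʳ (suc i) zero    v = tt
  midComp-identityʳ (suc i) (suc k) v = midComp-identityʳ i k v

  midComp-zeroˡ : ∀ {m} (i j k : Fin m) u → midEq i k (midComp i j k (midBot j k) u) (midBot i k)
  midComp-zeroˡ zero    zero    zero    u = tt
  midComp-zeroˡ zero    zero    (suc k) u = tt
  midComp-zeroˡ zero    (suc j) zero    u = tt
  midComp-zeroˡ zero    (suc j) (suc k) u = tt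
  midComp-zeroˡ (suc i) zero    zero    u = tt
  midComp-zeroˡ (suc i) (suc j) zero    u = tt
  midComp-zeroˡ (suc i) zero    (suc k) u = MidOrder.Eq.refl i k
  midComp-zeroˡ (suc i) (suc j) (suc k) u = midComp-zeroˡ i j k u

  midComp-zeroʳ : ∀ {m} (i j k : Fin m) v → midEq i k (midComp i j k v (midBot i j)) (midBot i k)
  midComp-zeroʳ zero    zero    zero    v = ≡⇒≈₂ (∧₂-zeroʳ v)
  midComp-zeroʳ zero    zero    (suc k) v = tt
  midComp-zeroʳ zero    (suc j) zero    v = tt
  midComp-zeroʳ zero    (suc j) (suc k) v = tt
  midComp-zeroʳ (suc i) zero    zero    v = tt
  midComp-zeroʳ (suc i) (suc j) zero    v = tt
  midComp-zeroʳ (suc i) zero    (suc k) v = MidOrder.Eq.refl i k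
  midComp-zeroʳ (suc i) (suc j) (suc k) v = midComp-zeroʳ i j k v

  midComp-cong : ∀ {m} (i j k : Fin m) {v v′ u u′} → midEq j k v v′ → midEq i j u u′ →
                 midEq i k (midComp i j k v u) (midComp i j k v′ u′)
  midComp-cong zero    zero    zero    v≈v′ u≈u′ = ∧₂-cong v≈v′ u≈u′
  midComp-cong zero    zero    (suc k) _    _    = tt
  midComp-cong zero    (suc j) zero    _    _    = tt
  midComp-cong zero    (suc j) (suc k) _    _    = tt
  midComp-cong (suc i) zero    zero    _    _    = tt
  midComp-cong (suc i) (suc j) zero    _    _    = tt
  midComp-cong (suc i) zero    (suc k) _    _    = MidOrder.Eq.refl i k
  midComp-cong (suc i) (suc j) (suc k) v≈v′ u≈u′ = midComp-cong i j k v≈v′ u≈u′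

  midComp-assoc : ∀ {m} (i j k l : Fin m) w v u →
                  midEq i l (midComp i k l w (midComp i j k v u)) (midComp i j l (midComp j k l w v) u)
  midComp-assoc zero    zero    zero    zero    w v u = ≡⇒≈₂ (∧₂-assoc w v u)
  midComp-assoc zero    j       k       (suc l) w v u = tt
  midComp-assoc (suc i) j       k       zero    w v u = tt
  midComp-assoc zero    zero    (suc k) zero    w v u = tt
  midComp-assoc zero    (suc j) zero    zero    w v u = ≡⇒≈₂ (∧₂-zeroʳ w)
  midComp-assoc zero    (suc j) (suc k) zero    w v u = tt
  midComp-assoc (suc i) zero    zero    (suc l) w v u = MidOrder.Eq.refl i l
  midComp-assoc (suc i) zero    (suc k) (suc l) w v u = midComp-zeroʳ i k l w
  midComp-assoc (suc i) (suc j) zero    (suc l) w v u = MidOrder.Eq.sym i l (midComp-zeroˡ i j l u)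
  midComp-assoc (suc i) (suc j) (suc k) (suc l) w v u = midComp-assoc i j k l w v u

  module Two⊥ = Bottomed (≤₂-isPartialOrder {ℓ₁} {ℓ₂}) bot₂ (λ _ → tt)

  ∧₂-preservesJoinsˡ : ∀ (v : Two) {I : Set ι} (f : I → Two) j → IsJoin (_≤₂_ {ℓ = ℓ₂}) f j →
                       IsJoin (_≤₂_ {ℓ = ℓ₂}) (λ k → v ∧₂ f k) (v ∧₂ j)
  ∧₂-preservesJoinsˡ id₂  f j f∨ = f∨
  ∧₂-preservesJoinsˡ bot₂ f j f∨ = Two⊥.const-⊥-isJoin

  ∧₂-preservesJoinsʳ : ∀ (u : Two) {I : Set ι} (f : I → Two) j → IsJoin (_≤₂_ {ℓ = ℓ₂}) f j →
                       IsJoin (_≤₂_ {ℓ = ℓ₂}) (λ k → f k ∧₂ u) (j ∧₂ u)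
  ∧₂-preservesJoinsʳ u f j f∨ =
    IsJoin-resp ≤₂-isPartialOrder (λ k → ∧₂-scale (f k)) (∧₂-scale j) (Two⊥.scale-isJoin em u f j f∨)
    where
    ∧₂-scale : ∀ t → _≈₂_ {ℓ = ℓ₁} (t ∧₂ u) (if isId₂ t then u else bot₂)
    ∧₂-scale id₂  = ≈₂-refl u
    ∧₂-scale bot₂ = ≈₂-refl bot₂

  midComp-preservesJoinsˡ : ∀ {m} (i j k : Fin m) v {I : Set ι} (f : I → midGo i j) J → IsJoin (midLeq i j) f J →
                            IsJoin (midLeq i k) (λ t → midComp i j k v (f t)) (midComp i j k v J)
  midComp-preservesJoinsˡ zero    zero    zero    v f J f∨ = ∧₂-preservesJoinsˡ v f J f∨
  midComp-preservesJoinsˡ zero    zero    (suc k) v f J f∨ = Mid⊥.const-⊥-isJoin zero (suc k)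
  midComp-preservesJoinsˡ zero    (suc j) zero    v f J f∨ = Two⊥.const-⊥-isJoin
  midComp-preservesJoinsˡ zero    (suc j) (suc k) v f J f∨ = Mid⊥.const-⊥-isJoin zero (suc k)
  midComp-preservesJoinsˡ (suc i) zero    zero    v f J f∨ = Mid⊥.const-⊥-isJoin (suc i) zero
  midComp-preservesJoinsˡ (suc i) (suc j) zero    v f J f∨ = Mid⊥.const-⊥-isJoin (suc i) zero
  midComp-preservesJoinsˡ (suc i) zero    (suc k) v f J f∨ = Mid⊥.const-⊥-isJoin i k
  midComp-preservesJoinsˡ (suc i) (suc j) (suc k) v f J f∨ = midComp-preservesJoinsˡ i j k v f J f∨

  midComp-preservesJoinsʳ : ∀ {m} (i j k : Fin m) u {I : Set ι} (f : I → midGo j k) J → IsJoin (midLeq j k) f J →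
                            IsJoin (midLeq i k) (λ t → midComp i j k (f t) u) (midComp i j k J u)
  midComp-preservesJoinsʳ zero    zero    zero    u f J f∨ = ∧₂-preservesJoinsʳ u f J f∨
  midComp-preservesJoinsʳ zero    zero    (suc k) u f J f∨ = Mid⊥.const-⊥-isJoin zero (suc k)
  midComp-preservesJoinsʳ zero    (suc j) zero    u f J f∨ = Two⊥.const-⊥-isJoin
  midComp-preservesJoinsʳ zero    (suc j) (suc k) u f J f∨ = Mid⊥.const-⊥-isJoin zero (suc k)
  midComp-preservesJoinsʳ (suc i) zero    zero    u f J f∨ = Mid⊥.const-⊥-isJoin (suc i) zero
  midComp-preservesJoinsʳ (suc i) (suc j) zero    u f J f∨ = Mid⊥.const-⊥-isJoin (suc i) zero
  midComp-preservesJoinsʳ (suc i) zero    (suc k) u f J f∨ = Mid⊥.const-⊥-isJoin i k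
  midComp-preservesJoinsʳ (suc i) (suc j) (suc k) u f J f∨ = midComp-preservesJoinsʳ i j k u f J f∨

  Hom-isPartialOrder : ∀ a b → IsPartialOrder (Eq a b) (Leq a b)
  Hom-isPartialOrder 𝟎       𝟎       = ≤₂-isPartialOrder
  Hom-isPartialOrder 𝟎       (mid i) = P.isPartialOrder
  Hom-isPartialOrder 𝟎       ∞       = L₁.isPartialOrder
  Hom-isPartialOrder (mid i) 𝟎       = ⊤-isPartialOrder
  Hom-isPartialOrder (mid i) (mid j) = mid-isPartialOrder i j
  Hom-isPartialOrder (mid i) ∞       = L₂.isPartialOrder
  Hom-isPartialOrder ∞       𝟎       = ⊤-isPartialOrder
  Hom-isPartialOrder ∞       (mid j) = ⊤-isPartialOrder
  Hom-isPartialOrder ∞       ∞       = ≤₂-isPartialOrder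

  ⊥Hom : ∀ a b → Hom a b
  ⊥Hom 𝟎       𝟎       = bot₂
  ⊥Hom 𝟎       (mid i) = P.bot
  ⊥Hom 𝟎       ∞       = L₁.bot
  ⊥Hom (mid i) 𝟎       = tt
  ⊥Hom (mid i) (mid j) = midBot i j
  ⊥Hom (mid i) ∞       = L₂.bot
  ⊥Hom ∞       𝟎       = tt
  ⊥Hom ∞       (mid j) = tt
  ⊥Hom ∞       ∞       = bot₂

  ⊥Hom-minimum : ∀ a b x → Leq a b (⊥Hom a b) x
  ⊥Hom-minimum 𝟎       𝟎       x = tt
  ⊥Hom-minimum 𝟎       (mid i) x = bot-minimum P x
  ⊥Hom-minimum 𝟎       ∞       x = bot-minimum L₁ x
  ⊥Hom-minimum (mid i) 𝟎       x = tt
  ⊥Hom-minimum (mid i) (mid j) x = midBot-minimum i j x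
  ⊥Hom-minimum (mid i) ∞       x = bot-minimum L₂ x
  ⊥Hom-minimum ∞       𝟎       x = tt
  ⊥Hom-minimum ∞       (mid j) x = tt
  ⊥Hom-minimum ∞       ∞       x = tt

  module HomOrder (a b : Obj n) = IsPartialOrder (Hom-isPartialOrder a b)
  module Hom⊥ (a b : Obj n) = Bottomed (Hom-isPartialOrder a b) (⊥Hom a b) (⊥Hom-minimum a b)

  Hom-joins : ∀ a b {I : Set ι} (f : I → Hom a b) → Σ (Hom a b) (IsJoin (Leq a b) f)
  Hom-joins 𝟎       𝟎       f = Two-joins f
  Hom-joins 𝟎       (mid i) f = P.joins f
  Hom-joins 𝟎       ∞       f = L₁.joins f
  Hom-joins (mid i) 𝟎       f = One-joins f
  Hom-joins (mid i) (mid j) f = mid-joins i j f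
  Hom-joins (mid i) ∞       f = L₂.joins f
  Hom-joins ∞       𝟎       f = One-joins f
  Hom-joins ∞       (mid j) f = One-joins f
  Hom-joins ∞       ∞       f = Two-joins f

  ≈-refl : ∀ a b {x : Hom a b} → Eq a b x x
  ≈-refl a b = HomOrder.Eq.refl a b

  ≈-sym : ∀ a b {x y : Hom a b} → Eq a b x y → Eq a b y x
  ≈-sym a b = HomOrder.Eq.sym a b

  ≈-trans : ∀ a b {x y z : Hom a b} → Eq a b x y → Eq a b y z → Eq a b x z
  ≈-trans a b = HomOrder.Eq.trans a b

  midIsId-isJoin : ∀ a b (x : Hom a b) {m} (i k : Fin m) {I : Set ι} (f : I → midGo i k) J → IsJoin (midLeq i k) f J →
                   IsJoin (Leq a b) (λ t → if midIsId i k (f t) then x else ⊥Hom a b) (if midIsId i k J then x else ⊥Hom a b)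
  midIsId-isJoin a b x zero    zero    f J f∨ = Hom⊥.scale-isJoin a b em x f J f∨
  midIsId-isJoin a b x zero    (suc k) f J f∨ = Hom⊥.const-⊥-isJoin a b
  midIsId-isJoin a b x (suc i) zero    f J f∨ = Hom⊥.const-⊥-isJoin a b
  midIsId-isJoin a b x (suc i) (suc k) f J f∨ = midIsId-isJoin a b x i k f J f∨

  comp-cong : ∀ a b d {v v′ : Hom b d} {u u′ : Hom a b} →
              Eq b d v v′ → Eq a b u u′ → Eq a d (comp a b d v u) (comp a b d v′ u′)
  comp-cong 𝟎       𝟎       𝟎       v≈v′ u≈u′ = ∧₂-cong v≈v′ u≈u′
  comp-cong 𝟎       𝟎       (mid k) v≈v′ u≈u′ = Hom⊥.scale-cong 𝟎 (mid k) u≈u′ v≈v′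
  comp-cong 𝟎       𝟎       ∞       v≈v′ u≈u′ = Hom⊥.scale-cong 𝟎 ∞ u≈u′ v≈v′
  comp-cong 𝟎       (mid j) 𝟎       _    _    = tt
  comp-cong 𝟎       (mid j) (mid k) v≈v′ u≈u′ = Hom⊥.if-cong 𝟎 (mid k) (midIsId-cong j k v≈v′) u≈u′
  comp-cong 𝟎       (mid j) ∞       v≈v′ u≈u′ = conj-cong j u≈u′ v≈v′
  comp-cong 𝟎       ∞       𝟎       _    _    = tt
  comp-cong 𝟎       ∞       (mid k) _    _    = ≈-refl 𝟎 (mid k)
  comp-cong 𝟎       ∞       ∞       v≈v′ u≈u′ = Hom⊥.scale-cong 𝟎 ∞ v≈v′ u≈u′
  comp-cong (mid i) b       𝟎       _    _    = tt
  comp-cong (mid i) 𝟎       (mid k) _    _    = ≈-refl (mid i) (mid k)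
  comp-cong (mid i) 𝟎       ∞       _    _    = ≈-refl (mid i) ∞
  comp-cong (mid i) (mid j) (mid k) v≈v′ u≈u′ = midComp-cong i j k v≈v′ u≈u′
  comp-cong (mid i) (mid j) ∞       v≈v′ u≈u′ = Hom⊥.if-cong (mid i) ∞ (midIsId-cong i j u≈u′) v≈v′
  comp-cong (mid i) ∞       (mid k) _    _    = ≈-refl (mid i) (mid k)
  comp-cong (mid i) ∞       ∞       v≈v′ u≈u′ = Hom⊥.scale-cong (mid i) ∞ v≈v′ u≈u′
  comp-cong ∞       b       𝟎       _    _    = tt
  comp-cong ∞       b       (mid k) _    _    = tt
  comp-cong ∞       𝟎       ∞       _    _    = tt
  comp-cong ∞       (mid j) ∞       _    _    = tt
  comp-cong ∞       ∞       ∞       v≈v′ u≈u′ = ∧₂-cong v≈v′ u≈u′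

  comp-identityˡ : ∀ a b (u : Hom a b) → Eq a b (comp a b b (idm b) u) u
  comp-identityˡ 𝟎       𝟎       u = ≈-refl 𝟎 𝟎
  comp-identityˡ 𝟎       (mid i) u = Hom⊥.if-cong 𝟎 (mid i) (midIsId-midId i) (≈-refl 𝟎 (mid i))
  comp-identityˡ 𝟎       ∞       u = ≈-refl 𝟎 ∞
  comp-identityˡ (mid i) 𝟎       u = tt
  comp-identityˡ (mid i) (mid j) u = midComp-identityˡ i j u
  comp-identityˡ (mid i) ∞       u = ≈-refl (mid i) ∞
  comp-identityˡ ∞       𝟎       u = tt
  comp-identityˡ ∞       (mid j) u = tt
  comp-identityˡ ∞       ∞       u = ≈-refl ∞ ∞

  comp-identityʳ : ∀ a b (u : Hom a b) → Eq a b (comp a a b u (idm a)) u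
  comp-identityʳ 𝟎       𝟎       u = ≡⇒≈₂ (∧₂-identityʳ u)
  comp-identityʳ 𝟎       (mid i) u = ≈-refl 𝟎 (mid i)
  comp-identityʳ 𝟎       ∞       u = ≈-refl 𝟎 ∞
  comp-identityʳ (mid i) 𝟎       u = tt
  comp-identityʳ (mid i) (mid j) u = midComp-identityʳ i j u
  comp-identityʳ (mid i) ∞       u = Hom⊥.if-cong (mid i) ∞ (midIsId-midId i) (≈-refl (mid i) ∞)
  comp-identityʳ ∞       𝟎       u = tt
  comp-identityʳ ∞       (mid j) u = tt
  comp-identityʳ ∞       ∞       u = ≡⇒≈₂ (∧₂-identityʳ u)

  comp-preservesJoinsˡ : ∀ a b d (v : Hom b d) {I : Set ι} (f : I → Hom a b) (j : Hom a b) →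
                         IsJoin (Leq a b) f j → IsJoin (Leq a d) (λ k → comp a b d v (f k)) (comp a b d v j)
  comp-preservesJoinsˡ 𝟎       𝟎        𝟎       v f j f∨ = ∧₂-preservesJoinsˡ v f j f∨
  comp-preservesJoinsˡ 𝟎       𝟎        (mid k) v f j f∨ = Hom⊥.scale-isJoin 𝟎 (mid k) em v f j f∨
  comp-preservesJoinsˡ 𝟎       𝟎        ∞       v f j f∨ = Hom⊥.scale-isJoin 𝟎 ∞ em v f j f∨
  comp-preservesJoinsˡ 𝟎       (mid i)  𝟎       v f j f∨ = Hom⊥.const-⊥-isJoin 𝟎 𝟎
  comp-preservesJoinsˡ 𝟎       (mid i)  (mid k) v f j f∨ = Hom⊥.if-isJoin 𝟎 (mid k) (midIsId i k v) f j f∨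
  comp-preservesJoinsˡ 𝟎       (mid i)  ∞       v f j f∨ = Conjˡ.preserves-joins i v f j f∨
  comp-preservesJoinsˡ 𝟎       ∞        𝟎       v f j f∨ = Hom⊥.const-⊥-isJoin 𝟎 𝟎
  comp-preservesJoinsˡ 𝟎       ∞        (mid k) v f j f∨ = Hom⊥.const-⊥-isJoin 𝟎 (mid k)
  comp-preservesJoinsˡ 𝟎       ∞        ∞       v f j f∨ = Hom⊥.if-isJoin 𝟎 ∞ (isId₂ v) f j f∨
  comp-preservesJoinsˡ (mid i) b        𝟎       v f j f∨ = Hom⊥.const-⊥-isJoin (mid i) 𝟎
  comp-preservesJoinsˡ (mid i) 𝟎        (mid k) v f j f∨ = Hom⊥.const-⊥-isJoin (mid i) (mid k)
  comp-preservesJoinsˡ (mid i) 𝟎        ∞       v f j f∨ = Hom⊥.const-⊥-isJoin (mid i) ∞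
  comp-preservesJoinsˡ (mid i) (mid i′) (mid k) v f j f∨ = midComp-preservesJoinsˡ i i′ k v f j f∨
  comp-preservesJoinsˡ (mid i) (mid i′) ∞       v f j f∨ = midIsId-isJoin (mid i) ∞ v i i′ f j f∨
  comp-preservesJoinsˡ (mid i) ∞        (mid k) v f j f∨ = Hom⊥.const-⊥-isJoin (mid i) (mid k)
  comp-preservesJoinsˡ (mid i) ∞        ∞       v f j f∨ = Hom⊥.if-isJoin (mid i) ∞ (isId₂ v) f j f∨
  comp-preservesJoinsˡ ∞       b        𝟎       v f j f∨ = Hom⊥.const-⊥-isJoin ∞ 𝟎
  comp-preservesJoinsˡ ∞       b        (mid k) v f j f∨ = Hom⊥.const-⊥-isJoin ∞ (mid k)
  comp-preservesJoinsˡ ∞       𝟎        ∞       v f j f∨ = Hom⊥.const-⊥-isJoin ∞ ∞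
  comp-preservesJoinsˡ ∞       (mid i)  ∞       v f j f∨ = Hom⊥.const-⊥-isJoin ∞ ∞
  comp-preservesJoinsˡ ∞       ∞        ∞       v f j f∨ = ∧₂-preservesJoinsˡ v f j f∨

  comp-preservesJoinsʳ : ∀ a b d (u : Hom a b) {I : Set ι} (f : I → Hom b d) (j : Hom b d) →
                         IsJoin (Leq b d) f j → IsJoin (Leq a d) (λ k → comp a b d (f k) u) (comp a b d j u)
  comp-preservesJoinsʳ 𝟎       𝟎        𝟎       u f j f∨ = ∧₂-preservesJoinsʳ u f j f∨
  comp-preservesJoinsʳ 𝟎       𝟎        (mid k) u f j f∨ = Hom⊥.if-isJoin 𝟎 (mid k) (isId₂ u) f j f∨
  comp-preservesJoinsʳ 𝟎       𝟎        ∞       u f j f∨ = Hom⊥.if-isJoin 𝟎 ∞ (isId₂ u) f j f∨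
  comp-preservesJoinsʳ 𝟎       (mid i)  𝟎       u f j f∨ = Hom⊥.const-⊥-isJoin 𝟎 𝟎
  comp-preservesJoinsʳ 𝟎       (mid i)  (mid k) u f j f∨ = midIsId-isJoin 𝟎 (mid k) u i k f j f∨
  comp-preservesJoinsʳ 𝟎       (mid i)  ∞       u f j f∨ = Conjʳ.preserves-joins i u f j f∨
  comp-preservesJoinsʳ 𝟎       ∞        𝟎       u f j f∨ = Hom⊥.const-⊥-isJoin 𝟎 𝟎
  comp-preservesJoinsʳ 𝟎       ∞        (mid k) u f j f∨ = Hom⊥.const-⊥-isJoin 𝟎 (mid k)
  comp-preservesJoinsʳ 𝟎       ∞        ∞       u f j f∨ = Hom⊥.scale-isJoin 𝟎 ∞ em u f j f∨
  comp-preservesJoinsʳ (mid i) b        𝟎       u f j f∨ = Hom⊥.const-⊥-isJoin (mid i) 𝟎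
  comp-preservesJoinsʳ (mid i) 𝟎        (mid k) u f j f∨ = Hom⊥.const-⊥-isJoin (mid i) (mid k)
  comp-preservesJoinsʳ (mid i) 𝟎        ∞       u f j f∨ = Hom⊥.const-⊥-isJoin (mid i) ∞
  comp-preservesJoinsʳ (mid i) (mid i′) (mid k) u f j f∨ = midComp-preservesJoinsʳ i i′ k u f j f∨
  comp-preservesJoinsʳ (mid i) (mid i′) ∞       u f j f∨ = Hom⊥.if-isJoin (mid i) ∞ (midIsId i i′ u) f j f∨
  comp-preservesJoinsʳ (mid i) ∞        (mid k) u f j f∨ = Hom⊥.const-⊥-isJoin (mid i) (mid k)
  comp-preservesJoinsʳ (mid i) ∞        ∞       u f j f∨ = Hom⊥.scale-isJoin (mid i) ∞ em u f j f∨
  comp-preservesJoinsʳ ∞       b        𝟎       u f j f∨ = Hom⊥.const-⊥-isJoin ∞ 𝟎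
  comp-preservesJoinsʳ ∞       b        (mid k) u f j f∨ = Hom⊥.const-⊥-isJoin ∞ (mid k)
  comp-preservesJoinsʳ ∞       𝟎        ∞       u f j f∨ = Hom⊥.const-⊥-isJoin ∞ ∞
  comp-preservesJoinsʳ ∞       (mid i)  ∞       u f j f∨ = Hom⊥.const-⊥-isJoin ∞ ∞
  comp-preservesJoinsʳ ∞       ∞        ∞       u f j f∨ = ∧₂-preservesJoinsʳ u f j f∨

  comp-assoc : ∀ a b d e (w : Hom d e) (v : Hom b d) (u : Hom a b) →
               Eq a e (comp a d e w (comp a b d v u)) (comp a b e (comp b d e w v) u)
  comp-assoc 𝟎       𝟎       𝟎       𝟎       w v    u    = ≡⇒≈₂ (∧₂-assoc w v u)
  comp-assoc 𝟎       𝟎       𝟎       (mid l) w id₂  u    = ≈-refl 𝟎 (mid l)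
  comp-assoc 𝟎       𝟎       𝟎       (mid l) w bot₂ u    = ≈-sym 𝟎 (mid l) (Hom⊥.if-⊥ 𝟎 (mid l) (isId₂ u))
  comp-assoc 𝟎       𝟎       𝟎       ∞       w id₂  u    = ≈-refl 𝟎 ∞
  comp-assoc 𝟎       𝟎       𝟎       ∞       w bot₂ u    = ≈-sym 𝟎 ∞ (Hom⊥.if-⊥ 𝟎 ∞ (isId₂ u))
  comp-assoc 𝟎       𝟎       (mid k) 𝟎       w v    u    = tt
  comp-assoc 𝟎       𝟎       (mid k) (mid l) w v    u    = Hom⊥.if-comm 𝟎 (mid l) (midIsId k l w) (isId₂ u) v
  comp-assoc 𝟎       𝟎       (mid k) ∞       w v    id₂  = ≈-refl 𝟎 ∞
  comp-assoc 𝟎       𝟎       (mid k) ∞       w v    bot₂ = conj-zeroˡ k w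
  comp-assoc 𝟎       𝟎       ∞       𝟎       w v    u    = tt
  comp-assoc 𝟎       𝟎       ∞       (mid l) w v    u    = ≈-sym 𝟎 (mid l) (Hom⊥.if-⊥ 𝟎 (mid l) (isId₂ u))
  comp-assoc 𝟎       𝟎       ∞       ∞       w v    u    = Hom⊥.if-comm 𝟎 ∞ (isId₂ w) (isId₂ u) v
  comp-assoc 𝟎       (mid j) 𝟎       𝟎       w v    u    = ≡⇒≈₂ (∧₂-zeroʳ w)
  comp-assoc 𝟎       (mid j) 𝟎       (mid l) w v    u    =
    ≈-sym 𝟎 (mid l) (Hom⊥.if-cong 𝟎 (mid l) (midIsId-midBot j l) (≈-refl 𝟎 (mid l)))
  comp-assoc 𝟎       (mid j) 𝟎       ∞       w v    u    = ≈-sym 𝟎 ∞ (conj-zeroʳ j u)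
  comp-assoc 𝟎       (mid j) (mid k) 𝟎       w v    u    = tt
  comp-assoc 𝟎       (mid j) (mid k) (mid l) w v    u    =
    ≈-trans 𝟎 (mid l) (Hom⊥.if-∧ 𝟎 (mid l) (midIsId k l w) (midIsId j k v) u)
      (Hom⊥.if-cong 𝟎 (mid l) (≡.sym (midIsId-midComp j k l w v)) (≈-refl 𝟎 (mid l)))
  comp-assoc 𝟎       (mid j) (mid k) ∞       w v    u    with midIsId j k v in v-id
  ... | true  with midIsId⇒≡ j k v v-id
  ...   | refl = ≈-refl 𝟎 ∞
  comp-assoc 𝟎       (mid j) (mid k) ∞       w v    u    | false =
    ≈-trans 𝟎 ∞ (conj-zeroˡ k w) (≈-sym 𝟎 ∞ (conj-zeroʳ j u))
  comp-assoc 𝟎       (mid j) ∞       𝟎       w v    u    = tt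
  comp-assoc 𝟎       (mid j) ∞       (mid l) w v    u    =
    ≈-sym 𝟎 (mid l) (Hom⊥.if-cong 𝟎 (mid l) (midIsId-midBot j l) (≈-refl 𝟎 (mid l)))
  comp-assoc 𝟎       (mid j) ∞       ∞       id₂  v    u    = ≈-refl 𝟎 ∞
  comp-assoc 𝟎       (mid j) ∞       ∞       bot₂ v    u    = ≈-sym 𝟎 ∞ (conj-zeroʳ j u)
  comp-assoc 𝟎       ∞       𝟎       𝟎       w v    u    = ≡⇒≈₂ (∧₂-zeroʳ w)
  comp-assoc 𝟎       ∞       𝟎       (mid l) w v    u    = ≈-refl 𝟎 (mid l)
  comp-assoc 𝟎       ∞       𝟎       ∞       w v    u    = ≈-refl 𝟎 ∞
  comp-assoc 𝟎       ∞       (mid k) 𝟎       w v    u    = tt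
  comp-assoc 𝟎       ∞       (mid k) (mid l) w v    u    = Hom⊥.if-⊥ 𝟎 (mid l) (midIsId k l w)
  comp-assoc 𝟎       ∞       (mid k) ∞       w v    u    = conj-zeroˡ k w
  comp-assoc 𝟎       ∞       ∞       𝟎       w v    u    = tt
  comp-assoc 𝟎       ∞       ∞       (mid l) w v    u    = ≈-refl 𝟎 (mid l)
  comp-assoc 𝟎       ∞       ∞       ∞       id₂  v    u    = ≈-refl 𝟎 ∞
  comp-assoc 𝟎       ∞       ∞       ∞       bot₂ v    u    = ≈-refl 𝟎 ∞
  comp-assoc (mid i) b       d       𝟎       w v    u    = tt
  comp-assoc (mid i) 𝟎       𝟎       (mid l) w v    u    = ≈-refl (mid i) (mid l)
  comp-assoc (mid i) 𝟎       𝟎       ∞       w v    u    = ≈-refl (mid i) ∞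
  comp-assoc (mid i) 𝟎       (mid k) (mid l) w v    u    = midComp-zeroʳ i k l w
  comp-assoc (mid i) 𝟎       (mid k) ∞       w v    u    =
    Hom⊥.if-cong (mid i) ∞ (midIsId-midBot i k) (≈-refl (mid i) ∞)
  comp-assoc (mid i) 𝟎       ∞       (mid l) w v    u    = ≈-refl (mid i) (mid l)
  comp-assoc (mid i) 𝟎       ∞       ∞       w v    u    = Hom⊥.if-⊥ (mid i) ∞ (isId₂ w)
  comp-assoc (mid i) (mid j) 𝟎       (mid l) w v    u    = ≈-sym (mid i) (mid l) (midComp-zeroˡ i j l u)
  comp-assoc (mid i) (mid j) 𝟎       ∞       w v    u    = ≈-sym (mid i) ∞ (Hom⊥.if-⊥ (mid i) ∞ (midIsId i j u))
  comp-assoc (mid i) (mid j) (mid k) (mid l) w v    u    = midComp-assoc i j k l w v u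
  comp-assoc (mid i) (mid j) (mid k) ∞       w v    u    =
    ≈-trans (mid i) ∞
      (Hom⊥.if-cong (mid i) ∞ (≡.trans (midIsId-midComp i j k v u) (∧-comm (midIsId j k v) (midIsId i j u)))
                    (≈-refl (mid i) ∞))
      (≈-sym (mid i) ∞ (Hom⊥.if-∧ (mid i) ∞ (midIsId i j u) (midIsId j k v) w))
  comp-assoc (mid i) (mid j) ∞       (mid l) w v    u    = ≈-sym (mid i) (mid l) (midComp-zeroˡ i j l u)
  comp-assoc (mid i) (mid j) ∞       ∞       w v    u    = Hom⊥.if-comm (mid i) ∞ (isId₂ w) (midIsId i j u) v
  comp-assoc (mid i) ∞       𝟎       (mid l) w v    u    = ≈-refl (mid i) (mid l)
  comp-assoc (mid i) ∞       𝟎       ∞       w v    u    = ≈-refl (mid i) ∞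
  comp-assoc (mid i) ∞       (mid k) (mid l) w v    u    = midComp-zeroʳ i k l w
  comp-assoc (mid i) ∞       (mid k) ∞       w v    u    =
    Hom⊥.if-cong (mid i) ∞ (midIsId-midBot i k) (≈-refl (mid i) ∞)
  comp-assoc (mid i) ∞       ∞       (mid l) w v    u    = ≈-refl (mid i) (mid l)
  comp-assoc (mid i) ∞       ∞       ∞       id₂  v    u    = ≈-refl (mid i) ∞
  comp-assoc (mid i) ∞       ∞       ∞       bot₂ v    u    = ≈-refl (mid i) ∞
  comp-assoc ∞       b       d       𝟎       w v    u    = tt
  comp-assoc ∞       b       d       (mid l) w v    u    = tt
  comp-assoc ∞       𝟎       𝟎       ∞       w v    u    = tt
  comp-assoc ∞       𝟎       (mid k) ∞       w v    u    = tt
  comp-assoc ∞       𝟎       ∞       ∞       w v    u    = ≡⇒≈₂ (∧₂-zeroʳ w)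
  comp-assoc ∞       (mid j) 𝟎       ∞       w v    u    = tt
  comp-assoc ∞       (mid j) (mid k) ∞       w v    u    = tt
  comp-assoc ∞       (mid j) ∞       ∞       w v    u    = ≡⇒≈₂ (∧₂-zeroʳ w)
  comp-assoc ∞       ∞       𝟎       ∞       w v    u    = tt
  comp-assoc ∞       ∞       (mid k) ∞       w v    u    = tt
  comp-assoc ∞       ∞       ∞       ∞       w v    u    = ≡⇒≈₂ (∧₂-assoc w v u)

  midId-nonTrivial : ∀ {m} (i : Fin m) (b : midGo i i) → (∀ x → midLeq i i b x) →
                     midLeq i i b (midId i) × ¬ midEq i i b (midId i)
  midId-nonTrivial zero    b b-min = Two-nonTrivial b b-min
  midId-nonTrivial (suc i) b b-min = midId-nonTrivial i b b-min

  nonTrivial : NonTrivial Q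
  nonTrivial 𝟎       b b-min = Two-nonTrivial b b-min
  nonTrivial (mid i) b b-min = midId-nonTrivial i b b-min
  nonTrivial ∞       b b-min = Two-nonTrivial b b-min

  isQuantaloid : IsQuantaloid ι Q
  isQuantaloid = record
    { isPartialOrder = Hom-isPartialOrder
    ; joins          = Hom-joins
    ; comp-cong      = comp-cong
    ; assoc          = comp-assoc
    ; identityˡ      = comp-identityˡ
    ; identityʳ      = comp-identityʳ
    ; comp-joinˡ     = comp-preservesJoinsˡ
    ; comp-joinʳ     = comp-preservesJoinsʳ
    }

  leftImplication : ∀ i u w → IsLeftImplication Q {𝟎} {mid i} {∞} u w (impR i w u)
  leftImplication i u w v = conj-adjointʳ i u v w

  rightImplication : ∀ i v w → IsRightImplication Q {𝟎} {mid i} {∞} v w (impL i w v)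
  rightImplication i v w u = adjoint₁ i u v w

proposition5p2 : ∀ {n : ℕ} {c ℓ₁ ℓ₂ ι : Level} → ExcludedMiddle ι →
    (𝓛 : MultiAdjointPropertyOrientedFrame n c ℓ₁ ℓ₂ ι) →
    let open MultiAdjointPropertyOrientedFrame 𝓛 in
    IsQuantaloid ι (Q-P 𝓛) × NonTrivial (Q-P 𝓛)
    × (∀ (i : Fin n) u w → IsLeftImplication (Q-P 𝓛) {𝟎} {mid i} {∞} u w (impR i w u))
    × (∀ (i : Fin n) v w → IsRightImplication (Q-P 𝓛) {𝟎} {mid i} {∞} v w (impL i w v))
proposition5p2 em 𝓛 = isQuantaloid , nonTrivial , leftImplication , rightImplication
  where open QuantaloidQP em 𝓛
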